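{- Let $D$ be a locatable digraph of order $n$. Then $\gamma_{OL}(D)=n$ if and only if $D$ can be constructed as follows. (1) Choose a partition of $V(D)$ into vertex sets of directed cycles $C_1,\dots,C_k$ (of lengths $n_1+\dots+n_k=n$, cycles of length $1$ being loops and of length $2$ being pairs of opposite arcs); these cycles will be exactly the forcing arcs of $D$, and for a vertex $v$ we write $f^-(v)$ and $f^+(v)$ for its predecessor and successor on its cycle. (2) Choose a partition of $V(D)$ into a set $V_d$ (to be the domination-forced vertices) and a set $V_l$ (to be the location-forced vertices). (3) Construct a digraph $\mathcal{H}$ on $V(D)$ which is a disjoint union of rooted directed trees (possibly single vertices), whose roots are exactly the vertices $f^+(x)$ for $x\in V_d$; in particular for every $x\in V_l$ the vertex $f^+(x)$ has an in-neighbour in $\mathcal{H}$. (4) The arcs of $D$ are the arcs of the cycles $C_1,\dots,C_k$ together with, for each tree $T$ of $\mathcal{H}$ and each vertex $v$ of $T$, an arc from $f^-(v)$ to every descendant of $v$ in $T$.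
   Context: Digraphs are finite and may contain loops; for each ordered pair $(x,y)$ there is at most one arc $xy$. $N^-(v)$ is the set of vertices $u$ such that $uv$ is an arc (including $v$ if $v$ has a loop). An OLD set of $D$ is a set $S\subseteq V(D)$ such that every vertex has an in-neighbour in $S$ and for every two distinct vertices $u,v$, some vertex of $S$ lies in $N^-(u)\ominus N^-(v)$ (symmetric difference). $D$ is locatable if it admits an OLD set; $\gamma_{OL}(D)$ is the minimum size of an OLD set. A vertex $v$ is domination-forced if some vertex $w$ has $N^-(w)=\{v\}$; location-forced if there are distinct $x,y$ with $N^-(x)\ominus N^-(y)=\{v\}$. An arc $xy$ is forcing if $N^-(y)=\{x\}$ or there is a vertex $z$ with $N^-(y)\ominus N^-(z)=\{x\}$. A rooted directed tree is a loopless digraph whose underlying graph is a tree, with a single vertex of in-degree $0$ (the root) and all arcs oriented away from the root; the descendants of $v$ are the vertices reachable from $v$ by a nonempty directed path in the tree. -}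

module Defs where

open import Data.Nat using (ℕ; _≤_)
open import Data.Bool using (Bool; true; false)
open import Data.Fin using (Fin)
open import Data.Fin.Subset using (Subset; _∈_; ∣_∣)
open import Data.Fin.Permutation using (Permutation′; _⟨$⟩ʳ_; _⟨$⟩ˡ_)
open import Data.Maybe using (Maybe; just; nothing)
open import Data.Product using (Σ; _×_; ∃; ∃-syntax)
open import Data.Sum using (_⊎_)
open import Relation.Nullary using (¬_)
open import Relation.Binary.PropositionalEquality using (_≡_; _≢_)
open import Function.Bundles using (_⇔_)

-- A digraph on vertex set Fin n: D u v ≡ true iff uv is an arc.
-- Loops allowed (D v v), at most one arc per ordered pair.
Digraph : ℕ → Set
Digraph n = Fin n → Fin n → Bool

Arc : ∀ {n} → Digraph n → Fin n → Fin n → Set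
Arc D u v = D u v ≡ true

InNbr : ∀ {n} → Digraph n → Fin n → Fin n → Set
InNbr D u v = Arc D u v

InSymDiff : ∀ {n} → Digraph n → Fin n → Fin n → Fin n → Set
InSymDiff D w u v =
  (InNbr D w u × ¬ InNbr D w v) ⊎ (¬ InNbr D w u × InNbr D w v)

IsOLD : ∀ {n} → Digraph n → Subset n → Set
IsOLD {n} D S =
  (∀ (v : Fin n) → ∃[ u ] (u ∈ S × InNbr D u v)) ×
  (∀ (u v : Fin n) → u ≢ v → ∃[ w ] (w ∈ S × InSymDiff D w u v))

Locatable : ∀ {n} → Digraph n → Set
Locatable {n} D = ∃[ S ] IsOLD {n} D S

γOL≡ : ∀ {n} → Digraph n → ℕ → Set
γOL≡ {n} D k =
  (∃[ S ] (IsOLD D S × ∣ S ∣ ≡ k)) ×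
  (∀ (S : Subset n) → IsOLD D S → k ≤ ∣ S ∣)

-- A disjoint union of rooted directed trees on Fin n, given by a parent
-- function: parent u ≡ just v means vu is an arc of the forest;
-- parent r ≡ nothing means r is a root.
data Desc {n} (par : Fin n → Maybe (Fin n)) (v : Fin n) : Fin n → Set where
  child : ∀ {u} → par u ≡ just v → Desc par v u
  step  : ∀ {u w} → par u ≡ just w → Desc par v w → Desc par v u

-- Forest condition: no directed cycle.  (On a finite vertex set, a parent
-- function without directed cycles is exactly a disjoint union of rooted
-- directed trees, the roots being the vertices without parent.)
IsRootedForest : ∀ {n} → (Fin n → Maybe (Fin n)) → Set
IsRootedForest {n} par = ∀ (v : Fin n) → ¬ Desc par v v

IsRoot : ∀ {n} → (Fin n → Maybe (Fin n)) → Fin n → Set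
IsRoot par r = par r ≡ nothing

-- The construction of the theorem.
-- f : permutation encoding the cycle partition C_1..C_k (f⁺ v = f ⟨$⟩ʳ v,
--     f⁻ v = f ⟨$⟩ˡ v);
-- inVd : characteristic function of V_d (V_l is the complement);
-- par : the forest H.
Constructible : ∀ {n} → Digraph n → Set
Constructible {n} D =
  Σ (Permutation′ n) λ f →
  Σ (Fin n → Bool) λ inVd →
  Σ (Fin n → Maybe (Fin n)) λ par →
    IsRootedForest par ×
    (∀ (r : Fin n) → IsRoot par r ⇔ (∃[ x ] (inVd x ≡ true × f ⟨$⟩ʳ x ≡ r))) ×
    (∀ (u w : Fin n) →
       Arc D u w ⇔ ((f ⟨$⟩ʳ u ≡ w) ⊎ (∃[ v ] (u ≡ f ⟨$⟩ˡ v × Desc par v w))))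

{-# OPTIONS --safe #-}
module Submission where

-- Call v forced when two of the n + 1 sets ∅, N⁻(x) differ at most in v.  A forced vertex
-- lies in every OLD set, while for an unforced v the set V - v is already OLD; so
-- γ_OL(D) = n exactly when every vertex is forced.  In a constructed digraph f⁺(v) shows
-- that v is forced.  Conversely, if every v is forced, locatability turns each v into an
-- edge of the hypercube {0,1}ⁿ in direction v between two of those n + 1 points, whose upper
-- end is N⁻(f⁺ v).  Edges in distinct directions can be contracted one at a time, each
-- merging two classes; contracting all but two of them leaves three classes, too few for the
-- four corners that two edges with a common upper end would produce.  Hence f⁺ is a
-- permutation, the lower end at f⁻(w) is ∅ or N⁻ of the parent of w, and in-neighbourhoods
-- grow strictly down the tree, which gives both acyclicity and the description of the arcs.

open import Defs

open import Data.Bool using (Bool; true; false)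
import Data.Bool.Properties as Bool
open import Data.Empty using (⊥; ⊥-elim)
open import Data.Fin using (Fin; zero; suc; _≟_; punchIn; punchOut)
open import Data.Fin.Properties
  using (suc-injective; 0≢1+n; any?; all?; ¬∀⟶∃¬; punchIn-injective; punchInᵢ≢i;
         punchIn-punchOut; punchOut-injective; injective⇒≤)
open import Data.Fin.Permutation
  using (Permutation′; permutation; _⟨$⟩ʳ_; _⟨$⟩ˡ_; inverseˡ; inverseʳ)
open import Data.Fin.Subset using (Subset; _∈_; _⊂_; ∣_∣; ⊤; ⁅_⁆; ∁)
open import Data.Fin.Subset.Induction using (⊂-wellFounded)
open import Data.Fin.Subset.Properties
  using (∣p∣≤n; ∣⊤∣≡n; p⊆q⇒∣p∣≤∣q∣; ∣∁p∣≡n∸∣p∣; ∣⁅x⁆∣≡1; x∉p⇒x∈∁p; x≢y⇒x∉⁅y⁆;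
         ⊂-trans; ⊂-irref)
open import Data.Maybe using (Maybe; just; nothing; is-nothing)
open import Data.Nat using (ℕ; zero; suc; _+_; _∸_; _≤_; _<_)
open import Data.Nat.Properties
  using (+-suc; +-identityʳ; +-monoˡ-≤; <-irrefl; ≤-antisym; ≤-reflexive; <⇒≱)
open import Data.Product using (Σ-syntax; _×_; _,_; proj₁; proj₂; ∃-syntax)
open import Data.Sum using (_⊎_; inj₁; inj₂)
open import Data.Vec using (tabulate)
open import Data.Vec.Properties using (lookup∘tabulate; lookup⇒[]=; []=⇒lookup)
open import Function.Base using (id; _∘_)
open import Function.Bundles using (_⇔_; mk⇔; Equivalence)
open import Function.Definitions using (Injective)
open import Induction.WellFounded using (Acc; acc)
open import Relation.Binary.PropositionalEquality
open import Relation.Nullary using (¬_; ¬?; Dec; yes; no)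
open import Relation.Nullary.Decidable using (_×-dec_; _→-dec_)

Avoids : ∀ {m n} → (Fin m → Fin n) → Fin n → Set
Avoids ι u = ∀ i → ι i ≢ u

module Hypercube {a} {A : Set a} {M n : ℕ} (P : Fin M → Fin n → A) where

  record Edge (v : Fin n) : Set a where
    field
      end₁ end₂ : Fin M
      differ    : P end₁ v ≢ P end₂ v
      agree     : ∀ u → u ≢ v → P end₁ u ≡ P end₂ u

  record Collapse (Q : Fin n → Set) (k : ℕ) : Set a where
    field
      class : Fin M → Fin k
      sound : ∀ {p q} → class p ≡ class q → ∀ u → Q u → P p u ≡ P q u

  collapse-mono : ∀ {Q Q′ : Fin n → Set} {k} → (∀ {u} → Q′ u → Q u) → Collapse Q k → Collapse Q′ k
  collapse-mono Q′⇒Q C = record { class = class ; sound = λ eq u → sound eq u ∘ Q′⇒Q }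
    where open Collapse C

  -- The ends of the edge differ at v, so Q v puts them in different classes, which are then merged.
  collapse-edge : ∀ {Q k v} → Collapse Q (suc k) → Edge v → Q v → Collapse (λ u → Q u × u ≢ v) k
  collapse-edge {Q} {k} {v} C E Qv = record { class = class′ ; sound = sound′ }
    where
    open Collapse C
    open Edge E

    ends-apart : class end₁ ≢ class end₂
    ends-apart eq = differ (sound eq v Qv)

    representative : (p : Fin M) →
      Σ[ r ∈ Fin M ] (class end₂ ≢ class r × (∀ u → Q u × u ≢ v → P r u ≡ P p u))
    representative p with class p ≟ class end₂
    ... | yes p~end₂ = end₁ , ends-apart ∘ sym ,
                       λ u (Qu , u≢v) → trans (agree u u≢v) (sound (sym p~end₂) u Qu)
    ... | no p≁end₂  = p , p≁end₂ ∘ sym , λ _ _ → refl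

    apart : ∀ p → class end₂ ≢ class (proj₁ (representative p))
    apart p = proj₁ (proj₂ (representative p))

    class′ : Fin M → Fin k
    class′ p = punchOut (apart p)

    sound′ : ∀ {p q} → class′ p ≡ class′ q → ∀ u → Q u × u ≢ v → P p u ≡ P q u
    sound′ {p} {q} eq u Q′u = begin
      P p u  ≡⟨ sym (agree-p u Q′u) ⟩
      P rp u ≡⟨ sound (punchOut-injective (apart p) (apart q) eq) u (proj₁ Q′u) ⟩
      P rq u ≡⟨ agree-q u Q′u ⟩
      P q u  ∎
      where
      open ≡-Reasoning
      rp = proj₁ (representative p)
      rq = proj₁ (representative q)
      agree-p = proj₂ (proj₂ (representative p))
      agree-q = proj₂ (proj₂ (representative q))

  contraction : ∀ {m} (ι : Fin m → Fin n) → Injective _≡_ _≡_ ι → (∀ i → Edge (ι i)) →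
                ∃[ k ] (k + m ≡ M × Collapse (Avoids ι) k)
  contraction {zero} ι _ _ =
    M , +-identityʳ M , record { class = id ; sound = λ { refl _ _ → refl } }
  contraction {suc m} ι ι-inj edges
    with contraction (ι ∘ suc) (suc-injective ∘ ι-inj) (edges ∘ suc)
  ... | zero , _ , C with Collapse.class C (Edge.end₁ (edges zero))
  ...   | ()
  contraction {suc m} ι ι-inj edges | suc k , k+m≡M , C =
    k , trans (+-suc k m) k+m≡M ,
    collapse-mono (λ avoids → (avoids ∘ suc) , avoids zero ∘ sym)
      (collapse-edge C (edges zero) (λ i → 0≢1+n ∘ sym ∘ ι-inj))

open Hypercube using (Edge; Collapse; contraction)

bits : Fin 4 → Bool × Bool
bits zero                   = false , false
bits (suc zero)             = false , true
bits (suc (suc zero))       = true  , false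
bits (suc (suc (suc zero))) = true  , true

unbits : Bool × Bool → Fin 4
unbits (false , false) = zero
unbits (false , true)  = suc zero
unbits (true  , false) = suc (suc zero)
unbits (true  , true)  = suc (suc (suc zero))

bits-injective : Injective _≡_ _≡_ bits
bits-injective {i} {j} eq = trans (sym (unbits∘bits i)) (trans (cong unbits eq) (unbits∘bits j))
  where
  unbits∘bits : ∀ i → unbits (bits i) ≡ i
  unbits∘bits zero                   = refl
  unbits∘bits (suc zero)             = refl
  unbits∘bits (suc (suc zero))       = refl
  unbits∘bits (suc (suc (suc zero))) = refl

omitTwo : ∀ {m} {v w : Fin (suc (suc m))} → v ≢ w →
          Σ[ ι ∈ (Fin m → Fin (suc (suc m))) ] (Injective _≡_ _≡_ ι × Avoids ι v × Avoids ι w)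
omitTwo {v = v} {w} v≢w =
  punchIn v ∘ punchIn w′ ,
  punchIn-injective w′ _ _ ∘ punchIn-injective v _ _ ,
  (λ i → punchInᵢ≢i v _) ,
  λ i e → punchInᵢ≢i w′ i (punchIn-injective v _ _ (trans e (sym (punchIn-punchOut v≢w))))
  where
  w′ = punchOut v≢w

-- Contracting the n - 2 edges in the other directions leaves only three classes.
noFourCorners : ∀ {n} (P : Fin (suc n) → Fin n → Bool) → (∀ v → Edge P v) →
                ∀ {v w} → v ≢ w → (corner : Bool × Bool → Fin (suc n)) →
                (∀ β → (P (corner β) v , P (corner β) w) ≡ β) → ⊥
noFourCorners {suc zero} P edges {zero} {zero} v≢w = ⊥-elim (v≢w refl)
noFourCorners {suc (suc m)} P edges {v} {w} v≢w corner corner-coords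
  with omitTwo v≢w
... | ι , ι-injective , avoids-v , avoids-w
  with contraction P ι ι-injective (edges ∘ ι)
... | k , k+m≡3+m , C = <-irrefl refl (subst (4 + m ≤_) k+m≡3+m (+-monoˡ-≤ m four≤k))
  where
  open Collapse C
  four≤k : 4 ≤ k
  four≤k = injective⇒≤ {f = class ∘ corner ∘ bits} λ {i} {j} eq → bits-injective (begin
    bits i                                          ≡⟨ sym (corner-coords (bits i)) ⟩
    (P (corner (bits i)) v , P (corner (bits i)) w)
      ≡⟨ cong₂ _,_ (sound eq v avoids-v) (sound eq w avoids-w) ⟩
    (P (corner (bits j)) v , P (corner (bits j)) w) ≡⟨ corner-coords (bits j) ⟩
    bits j                                          ∎)
    where open ≡-Reasoning

nbh : ∀ {n} → Digraph n → Fin (suc n) → Fin n → Bool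
nbh D zero    u = false
nbh D (suc x) u = D u x

-- p = zero is domination-forcing, p = suc x location-forcing; locatability makes the difference
-- exactly v.
Forced : ∀ {n} → Digraph n → Fin n → Set
Forced D v = ∃[ p ] ∃[ q ] (p ≢ q × (∀ u → u ≢ v → nbh D p u ≡ nbh D q u))

forced? : ∀ {n} (D : Digraph n) v → Dec (Forced D v)
forced? D v = any? λ p → any? λ q →
  ¬? (p ≟ q) ×-dec all? λ u → ¬? (u ≟ v) →-dec (nbh D p u Bool.≟ nbh D q u)

module _ {n} {D : Digraph n} where

  symDiff⇒≢ : ∀ {u x y} → InSymDiff D u x y → D u x ≢ D u y
  symDiff⇒≢ (inj₁ (u→x , u↛y)) eq = u↛y (trans (sym eq) u→x)
  symDiff⇒≢ (inj₂ (u↛x , u→y)) eq = u↛x (trans eq u→y)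

  ≢⇒symDiff : ∀ {u x y} → D u x ≢ D u y → InSymDiff D u x y
  ≢⇒symDiff {u} {x} {y} ne with D u x | D u y
  ... | true  | true  = ⊥-elim (ne refl)
  ... | true  | false = inj₁ (refl , λ ())
  ... | false | true  = inj₂ ((λ ()) , refl)
  ... | false | false = ⊥-elim (ne refl)

  OLD-separates : ∀ {S} → IsOLD D S → ∀ {p q} → p ≢ q → ∃[ u ] (u ∈ S × nbh D p u ≢ nbh D q u)
  OLD-separates (dominating , _) {zero} {zero} p≢q = ⊥-elim (p≢q refl)
  OLD-separates (dominating , _) {zero} {suc y} _ =
    let u , u∈S , u→y = dominating y in u , u∈S , Bool.not-¬ u→y ∘ sym
  OLD-separates (dominating , _) {suc x} {zero} _ =
    let u , u∈S , u→x = dominating x in u , u∈S , Bool.not-¬ u→x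
  OLD-separates (_ , separating) {suc x} {suc y} p≢q =
    let u , u∈S , u∈x⊖y = separating x y (p≢q ∘ cong suc) in u , u∈S , symDiff⇒≢ u∈x⊖y

  forced∈OLD : ∀ {v S} → Forced D v → IsOLD D S → v ∈ S
  forced∈OLD {v} (p , q , p≢q , agree) old with OLD-separates old p≢q
  ... | u , u∈S , differ with u ≟ v
  ...   | yes refl = u∈S
  ...   | no u≢v   = ⊥-elim (differ (agree u u≢v))

  allForced⇒γOL≡n : Locatable D → (∀ v → Forced D v) → γOL≡ D n
  allForced⇒γOL≡n (S , old) forced = (S , old , ≤-antisym (∣p∣≤n S) (n≤∣OLD∣ S old)) , n≤∣OLD∣
    where
    n≤∣OLD∣ : ∀ S → IsOLD D S → n ≤ ∣ S ∣
    n≤∣OLD∣ S old =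
      subst (_≤ ∣ S ∣) (∣⊤∣≡n n) (p⊆q⇒∣p∣≤∣q∣ {p = ⊤} λ {v} _ → forced∈OLD (forced v) old)

  unforced⇒OLD-without : ∀ {v} → ¬ Forced D v → IsOLD D (∁ ⁅ v ⁆)
  unforced⇒OLD-without {v} unforced =
    (λ w → let u , u≢v , differ = separated {zero} {suc w} λ ()
           in u , ∈-without u≢v , Bool.¬-not (differ ∘ sym)) ,
    (λ x y x≢y → let u , u≢v , differ = separated (x≢y ∘ suc-injective)
                 in u , ∈-without u≢v , ≢⇒symDiff differ)
    where
    ∈-without : ∀ {u} → u ≢ v → u ∈ ∁ ⁅ v ⁆
    ∈-without = x∉p⇒x∈∁p ∘ x≢y⇒x∉⁅y⁆
    separated : ∀ {p q} → p ≢ q → ∃[ u ] (u ≢ v × nbh D p u ≢ nbh D q u)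
    separated {p} {q} p≢q
      with ¬∀⟶∃¬ n _ (λ u → ¬? (u ≟ v) →-dec (nbh D p u Bool.≟ nbh D q u))
                       (λ agree → unforced (p , q , p≢q , agree))
    ... | u , disagree = u , (λ u≡v → disagree λ u≢v → ⊥-elim (u≢v u≡v)) , λ eq → disagree λ _ → eq

  minimal⇒allForced : (∀ S → IsOLD D S → n ≤ ∣ S ∣) → ∀ v → Forced D v
  minimal⇒allForced minimal v with forced? D v
  ... | yes forced = forced
  ... | no unforced = ⊥-elim (<⇒≱ (∣∁⁅x⁆∣<n v) (minimal _ (unforced⇒OLD-without unforced)))
    where
    ∣∁⁅x⁆∣<n : ∀ {n} (x : Fin n) → ∣ ∁ ⁅ x ⁆ ∣ < n
    ∣∁⁅x⁆∣<n {suc k} x =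
      ≤-reflexive (cong suc (trans (∣∁p∣≡n∸∣p∣ ⁅ x ⁆) (cong (suc k ∸_) (∣⁅x⁆∣≡1 x))))

module _ {n} {parent : Fin n → Maybe (Fin n)} where

  desc-root : ∀ {a w} → IsRoot parent w → ¬ Desc parent a w
  desc-root root (child w◁a)  with trans (sym w◁a) root
  ... | ()
  desc-root root (step w◁b _) with trans (sym w◁b) root
  ... | ()

  desc-parent : ∀ {a w p} → Desc parent a w → parent w ≡ just p → a ≡ p ⊎ Desc parent a p
  desc-parent (child w◁a)     w◁p with trans (sym w◁a) w◁p
  ... | refl = inj₁ refl
  desc-parent (step w◁b a⇝b) w◁p with trans (sym w◁b) w◁p
  ... | refl = inj₂ a⇝b

-- f⁺(v) witnesses that v is forced: its in-neighbourhood is that of its parent, or ∅ at a root,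
-- plus v.
constructible⇒allForced : ∀ {n} {D : Digraph n} → Constructible D → ∀ v → Forced D v
constructible⇒allForced {D = D} (f , _ , parent , forest , _ , arcs) v = forced-by (parent w) refl
  where
  w = f ⟨$⟩ʳ v
  arc⇒tree : ∀ {u x} → Arc D u x → (f ⟨$⟩ʳ u ≡ x) ⊎ (∃[ a ] (u ≡ f ⟨$⟩ˡ a × Desc parent a x))
  arc⇒tree = Equivalence.to (arcs _ _)
  tree⇒arc : ∀ {u x} → (f ⟨$⟩ʳ u ≡ x) ⊎ (∃[ a ] (u ≡ f ⟨$⟩ˡ a × Desc parent a x)) → Arc D u x
  tree⇒arc = Equivalence.from (arcs _ _)
  f⁻-of : ∀ {u x} → f ⟨$⟩ʳ u ≡ x → u ≡ f ⟨$⟩ˡ x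
  f⁻-of refl = sym (inverseˡ f)
  f⁺-injective : ∀ {u} → f ⟨$⟩ʳ u ≡ w → u ≡ v
  f⁺-injective f⁺u≡w = trans (f⁻-of f⁺u≡w) (inverseˡ f)

  forced-by : ∀ m → parent w ≡ m → Forced D v
  forced-by nothing w-root = zero , suc w , (λ ()) , λ u u≢v → sym (Bool.¬-not (no-arc u≢v))
    where
    no-arc : ∀ {u} → u ≢ v → ¬ Arc D u w
    no-arc u≢v u→w with arc⇒tree u→w
    ... | inj₁ f⁺u≡w          = u≢v (f⁺-injective f⁺u≡w)
    ... | inj₂ (_ , _ , a⇝w) = desc-root w-root a⇝w
  forced-by (just p) w◁p = suc p , suc w , p≢w ∘ suc-injective , λ u u≢v →
      Bool.⇔→≡ {z = true} (mk⇔ from-parent (to-parent u≢v))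
    where
    p≢w : p ≢ w
    p≢w refl = forest p (child w◁p)
    from-parent : ∀ {u} → Arc D u p → Arc D u w
    from-parent u→p with arc⇒tree u→p
    ... | inj₁ f⁺u≡p             = tree⇒arc (inj₂ (p , f⁻-of f⁺u≡p , child w◁p))
    ... | inj₂ (a , u≡f⁻a , a⇝p) = tree⇒arc (inj₂ (a , u≡f⁻a , step w◁p a⇝p))
    to-parent : ∀ {u} → u ≢ v → Arc D u w → Arc D u p
    to-parent u≢v u→w with arc⇒tree u→w
    ... | inj₁ f⁺u≡w = ⊥-elim (u≢v (f⁺-injective f⁺u≡w))
    ... | inj₂ (a , u≡f⁻a , a⇝w) with desc-parent a⇝w w◁p
    ...   | inj₁ refl = tree⇒arc (inj₁ (trans (cong (f ⟨$⟩ʳ_) u≡f⁻a) (inverseʳ f)))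
    ...   | inj₂ a⇝p  = tree⇒arc (inj₂ (a , u≡f⁻a , a⇝p))

injective⇒surjective : ∀ {n} {g : Fin n → Fin n} → Injective _≡_ _≡_ g → ∀ y → ∃[ x ] g x ≡ y
injective⇒surjective {suc m} {g} g-inj y with any? (λ x → g x ≟ y)
... | yes hit = hit
... | no miss = ⊥-elim (<-irrefl refl (injective⇒≤ {f = g-without-y} g-without-y-injective))
  where
  y≢g : ∀ x → y ≢ g x
  y≢g x = miss ∘ (x ,_) ∘ sym
  g-without-y : Fin (suc m) → Fin m
  g-without-y x = punchOut (y≢g x)
  g-without-y-injective : Injective _≡_ _≡_ g-without-y
  g-without-y-injective {x} {z} = g-inj ∘ punchOut-injective (y≢g x) (y≢g z)

∈-tabulate : ∀ {n} {f : Fin n → Bool} {u} → u ∈ tabulate f ⇔ f u ≡ true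
∈-tabulate {f = f} {u} = mk⇔
  (λ u∈ → trans (sym (lookup∘tabulate f u)) ([]=⇒lookup u∈))
  (λ fu → lookup⇒[]= u _ (trans (lookup∘tabulate f u) fu))

vertexOf : ∀ {n} → Fin (suc n) → Maybe (Fin n)
vertexOf zero    = nothing
vertexOf (suc x) = just x

vertexOf-just : ∀ {n} {q : Fin (suc n)} {p} → vertexOf q ≡ just p → q ≡ suc p
vertexOf-just {q = suc _} refl = refl

is-nothing-true : ∀ {A : Set} {m : Maybe A} → is-nothing m ≡ true → m ≡ nothing
is-nothing-true {m = nothing} _ = refl

record ForcingArc {n} (D : Digraph n) (v : Fin n) : Set where
  field
    head       : Fin n
    twin       : Fin (suc n)
    arc        : Arc D v head
    twin∌v     : nbh D twin v ≡ false
    twin-agree : ∀ u → u ≢ v → nbh D twin u ≡ D u head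

  edge : Edge (nbh D) v
  edge = record
    { end₁   = twin
    ; end₂   = suc head
    ; differ = λ eq → Bool.not-¬ twin∌v (trans eq arc)
    ; agree  = twin-agree
    }

module _ {n} {D : Digraph n} {v : Fin n} where

  forcingArc-from : ∀ p q → nbh D p v ≡ false → nbh D q v ≡ true →
                    (∀ u → u ≢ v → nbh D p u ≡ nbh D q u) → ForcingArc D v
  forcingArc-from p (suc y) p∌v y∋v agree = record
    { head = y ; twin = p ; arc = y∋v ; twin∌v = p∌v ; twin-agree = agree }

  forcingArc : Locatable D → Forced D v → ForcingArc D v
  forcingArc (_ , old) (p , q , p≢q , agree) with OLD-separates old p≢q
  ... | u , _ , differ with u ≟ v
  ...   | no u≢v   = ⊥-elim (differ (agree u u≢v))
  ...   | yes refl with nbh D q u in q∋v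
  ...     | true  = forcingArc-from p q (Bool.¬-not differ) q∋v agree
  ...     | false = forcingArc-from q p q∋v (Bool.¬-not differ) (λ u u≢v → sym (agree u u≢v))

module FromForced {n} {D : Digraph n} (located : Locatable D) (forced : ∀ v → Forced D v) where

  open ForcingArc

  F : ∀ v → ForcingArc D v
  F v = forcingArc located (forced v)

  f⁺ : Fin n → Fin n
  f⁺ v = head (F v)

  f⁺-injective : Injective _≡_ _≡_ f⁺
  f⁺-injective {v} {w} same-head with v ≟ w
  ... | yes v≡w = v≡w
  ... | no v≢w  = ⊥-elim (noFourCorners (nbh D) (edge ∘ F) v≢w corner corner-coords)
    where
    v→head-w : D v (f⁺ w) ≡ true
    v→head-w = subst (λ h → D v h ≡ true) same-head (arc (F v))
    w→head-v : D w (f⁺ v) ≡ true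
    w→head-v = subst (λ h → D w h ≡ true) (sym same-head) (arc (F w))
    -- ∅, N⁻(f⁺ v) - v, N⁻(f⁺ v) - w and N⁻(f⁺ v), using f⁺ v = f⁺ w
    corner : Bool × Bool → Fin (suc n)
    corner (false , false) = zero
    corner (false , true)  = twin (F v)
    corner (true  , false) = twin (F w)
    corner (true  , true)  = suc (f⁺ v)
    corner-coords : ∀ β → (nbh D (corner β) v , nbh D (corner β) w) ≡ β
    corner-coords (false , false) = refl
    corner-coords (false , true)  =
      cong₂ _,_ (twin∌v (F v)) (trans (twin-agree (F v) w (v≢w ∘ sym)) w→head-v)
    corner-coords (true  , false) =
      cong₂ _,_ (trans (twin-agree (F w) v v≢w) v→head-w) (twin∌v (F w))
    corner-coords (true  , true)  = cong₂ _,_ (arc (F v)) w→head-v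

  f⁻ : Fin n → Fin n
  f⁻ w = proj₁ (injective⇒surjective f⁺-injective w)

  f⁺∘f⁻ : ∀ w → f⁺ (f⁻ w) ≡ w
  f⁺∘f⁻ w = proj₂ (injective⇒surjective f⁺-injective w)

  f : Permutation′ n
  f = permutation f⁺ f⁻ f⁺∘f⁻ (λ v → f⁺-injective (f⁺∘f⁻ (f⁺ v)))

  f⁻-of : ∀ {u w} → f⁺ u ≡ w → u ≡ f⁻ w
  f⁻-of refl = sym (f⁺-injective (f⁺∘f⁻ _))

  parent : Fin n → Maybe (Fin n)
  parent w = vertexOf (twin (F (f⁻ w)))

  inVd : Fin n → Bool
  inVd x = is-nothing (parent (f⁺ x))

  tail-arc : ∀ w → D (f⁻ w) w ≡ true
  tail-arc w = subst (λ h → D (f⁻ w) h ≡ true) (f⁺∘f⁻ w) (arc (F (f⁻ w)))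

  inNbr-off-tail : ∀ {u w} → u ≢ f⁻ w → D u w ≡ nbh D (twin (F (f⁻ w))) u
  inNbr-off-tail {u} {w} u≢ =
    subst (λ h → D u h ≡ nbh D (twin (F (f⁻ w))) u) (f⁺∘f⁻ w) (sym (twin-agree (F (f⁻ w)) u u≢))

  parent-inNbr : ∀ {u w} → u ≢ f⁻ w → D u w ≡ true → ∃[ p ] (parent w ≡ just p × D u p ≡ true)
  parent-inNbr {u} {w} u≢ u→w with twin (F (f⁻ w)) | inNbr-off-tail u≢
  ... | zero  | decomp = ⊥-elim (Bool.not-¬ decomp u→w)
  ... | suc p | decomp = p , refl , trans (sym decomp) u→w

  inNbr-parent : ∀ {u w p} → parent w ≡ just p → D u p ≡ true → D u w ≡ true
  inNbr-parent {u} {w} w◁p u→p with u ≟ f⁻ w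
  ... | yes refl = tail-arc w
  ... | no u≢    =
    trans (inNbr-off-tail u≢) (trans (cong (λ z → nbh D z u) (vertexOf-just w◁p)) u→p)

  tail∉parent : ∀ {w p} → parent w ≡ just p → D (f⁻ w) p ≡ false
  tail∉parent {w} w◁p =
    subst (λ z → nbh D z (f⁻ w) ≡ false) (vertexOf-just w◁p) (twin∌v (F (f⁻ w)))

  inNbrs : Fin n → Subset n
  inNbrs w = tabulate (λ u → D u w)

  parent⇒⊂ : ∀ {w p} → parent w ≡ just p → inNbrs p ⊂ inNbrs w
  parent⇒⊂ {w} w◁p =
    (λ u∈p → Equivalence.from ∈-tabulate (inNbr-parent w◁p (Equivalence.to ∈-tabulate u∈p))) ,
    f⁻ w , Equivalence.from ∈-tabulate (tail-arc w) ,
    λ tail∈p → Bool.not-¬ (tail∉parent w◁p) (Equivalence.to ∈-tabulate tail∈p)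

  desc⇒⊂ : ∀ {v w} → Desc parent v w → inNbrs v ⊂ inNbrs w
  desc⇒⊂ (child w◁v)    = parent⇒⊂ w◁v
  desc⇒⊂ (step w◁b v⇝b) = ⊂-trans (desc⇒⊂ v⇝b) (parent⇒⊂ w◁b)

  forest : IsRootedForest parent
  forest v v⇝v = ⊂-irref refl (desc⇒⊂ v⇝v)

  roots : ∀ r → IsRoot parent r ⇔ (∃[ x ] (inVd x ≡ true × f ⟨$⟩ʳ x ≡ r))
  roots r = mk⇔
    (λ r-root → f⁻ r ,
                subst (λ z → is-nothing (parent z) ≡ true) (sym (f⁺∘f⁻ r)) (cong is-nothing r-root) ,
                f⁺∘f⁻ r)
    (λ { (x , x∈Vd , refl) → is-nothing-true x∈Vd })

  arc⇒tree : ∀ {u} w → Acc _⊂_ (inNbrs w) → D u w ≡ true →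
             (f⁺ u ≡ w) ⊎ (∃[ v ] (u ≡ f⁻ v × Desc parent v w))
  arc⇒tree {u} w (acc smaller) u→w with u ≟ f⁻ w
  ... | yes refl = inj₁ (f⁺∘f⁻ w)
  ... | no u≢ with parent-inNbr u≢ u→w
  ...   | p , w◁p , u→p with arc⇒tree p (smaller (parent⇒⊂ w◁p)) u→p
  ...     | inj₁ f⁺u≡p             = inj₂ (p , f⁻-of f⁺u≡p , child w◁p)
  ...     | inj₂ (v , u≡f⁻v , v⇝p) = inj₂ (v , u≡f⁻v , step w◁p v⇝p)

  desc⇒arc : ∀ {v w} → Desc parent v w → D (f⁻ v) w ≡ true
  desc⇒arc {v} (child w◁v)    = inNbr-parent w◁v (tail-arc v)
  desc⇒arc     (step w◁b v⇝b) = inNbr-parent w◁b (desc⇒arc v⇝b)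

  tree⇒arc : ∀ {u w} → (f⁺ u ≡ w) ⊎ (∃[ v ] (u ≡ f⁻ v × Desc parent v w)) → Arc D u w
  tree⇒arc (inj₁ refl)               = subst (λ z → D z (f⁺ _) ≡ true) (sym (f⁻-of refl)) (tail-arc _)
  tree⇒arc (inj₂ (v , refl , v⇝w)) = desc⇒arc v⇝w

  constructible : Constructible D
  constructible = f , inVd , parent , forest , roots ,
    λ u w → mk⇔ (arc⇒tree w (⊂-wellFounded (inNbrs w))) tree⇒arc

theorem2p15 : ∀ (n : ℕ) (D : Digraph n) → Locatable D →
    (γOL≡ D n ⇔ Constructible D)
theorem2p15 n D located = mk⇔
  (λ γOL≡n → FromForced.constructible located (minimal⇒allForced (proj₂ γOL≡n)))
  (λ constructed → allForced⇒γOL≡n located (constructible⇒allForced constructed))
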